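{- Let $b\geq 2$ be an integer with prime factorization $b=s_1^{k_1}\cdots s_l^{k_l}$, $S=\{s_1<\dots<s_l\}$ its set of prime factors, $k_1,\dots,k_l,l$ positive integers. Let $m_i=s_1^{r_{i,1}}\cdots s_l^{r_{i,l}}$ ($i\geq1$, $r_{i,j}\in\{0,1,2,\dots\}$), put $d_i=\sum_{j=1}^lr_{i,j}$, and assume that for some fixed $\epsilon>0$, $\inf_{1\le i<\infty} d_{i+1}/d_i\geq 1+\epsilon$. Let $\mathbf{a}_i$ be the $b$-ary expansion of $m_i$, $t_i$ its length, and $n_i=\sum_{j=1}^it_j$. Let $u_{n_i}$ be the positive integer whose $b$-ary expansion is $\mathbf{a}_1\mathbf{a}_2\cdots\mathbf{a}_i$ (i.e., the numerator of the $n_i$-th rational truncation of the number $(.\mathbf{a}_1\mathbf{a}_2\mathbf{a}_3\cdots)_b$). Then there exist constants $0<c\leq c'<\infty$, independent of $i$, such that $$b^{c\,d_i}\leq u_{n_i}\leq b^{c'd_i}\quad\text{for all } 1\le i<\infty.$$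
   Context: The $b$-ary expansion of a positive integer $u$ is the unique finite word $c_1\cdots c_k$ over $\{0,\dots,b-1\}$ with $c_1\ne0$ and $u=\sum_{i=1}^kc_ib^{k-i}$; its length is $k$. -}

module Defs where

open import Data.Nat using (ℕ; zero; suc; _+_; _*_; _^_)
open import Data.Nat.DivMod using (_/_; _%_)
open import Data.Fin using (Fin)
open import Data.List using (List; []; _∷_; _++_; [_]; foldl; concatMap; upTo; length)

prodF : (l : ℕ) → (Fin l → ℕ) → ℕ
prodF zero    f = 1
prodF (suc l) f = f Fin.zero * prodF l (λ j → f (Fin.suc j))

sumF : (l : ℕ) → (Fin l → ℕ) → ℕ
sumF zero    f = 0
sumF (suc l) f = f Fin.zero + sumF l (λ j → f (Fin.suc j))

-- For b ≥ 2 and u ≥ 1, fuel u suffices, giving the unique word c₁⋯c_k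
-- with c₁ ≠ 0 and u = Σ cᵢ b^(k-i).  (For u = 0 it is the empty word.)
digitsAux : (b : ℕ) → ℕ → ℕ → List ℕ
digitsAux zero    _        _       = []
digitsAux (suc b) zero     _       = []
digitsAux (suc b) (suc f)  zero    = []
digitsAux (suc b) (suc f)  (suc u) =
  digitsAux (suc b) f (suc u / suc b) ++ [ suc u % suc b ]

expansion : (b u : ℕ) → List ℕ
expansion b u = digitsAux b u u

value : (b : ℕ) → List ℕ → ℕ
value b = foldl (λ acc c → acc * b + c) 0

-- Data of the proposition (0-based indexing: index i here is index i+1 in the paper).
-- m i = ∏ s_j ^ r_{i,j}
mSeq : (l : ℕ) → (Fin l → ℕ) → (ℕ → Fin l → ℕ) → ℕ → ℕ
mSeq l s r i = prodF l (λ j → s j ^ r i j)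

dSeq : (l : ℕ) → (ℕ → Fin l → ℕ) → ℕ → ℕ
dSeq l r i = sumF l (r i)

uSeq : (b l : ℕ) → (Fin l → ℕ) → (ℕ → Fin l → ℕ) → ℕ → ℕ
uSeq b l s r i = value b (concatMap (λ j → expansion b (mSeq l s r j)) (upTo (suc i)))

{-# OPTIONS --safe #-}
-- A block aₖ is the expansion of mₖ, and 2^dₖ ≤ mₖ ≤ b^dₖ since every prime sⱼ
-- divides b (only 2 ≤ sⱼ ∣ b is used of the factorisation).
-- Lower bound: u_{n_i} ≥ m_i ≥ 2^{d_i} ≥ b^{d_i / b}, as b < 2^b.
-- Upper bound: u_{n_i} < b^{n_i} and each block has at most 2dₖ digits, so
-- n_i ≤ 2(d₁ + ⋯ + d_i); geometric growth dₖ₊₁ ≥ (1 + ε) dₖ bounds this partial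
-- sum by (1 + 1/ε) d_i.  Hence c = 1/b and c′ = 2(1 + 1/ε) work.
module Submission where

open import Defs
open import Data.Nat using (ℕ; zero; suc; _+_; _*_; _^_; _≤_; _<_; z≤n; s≤s; NonZero; >-nonZero; nonTrivial⇒n>1)
open import Data.Nat.Primality using (Prime; prime⇒nonTrivial)
open import Data.Product using (Σ; _×_; _,_)
open import Data.Nat.Properties
open import Data.Nat.DivMod using (_/_; _%_; m≡m%n+[m/n]*n; m%n<n; m/n<m; m<n*o⇒m/o<n)
open import Data.List using (List; []; _∷_; _++_; [_]; foldl; concat; concatMap; map; upTo; length)
open import Data.List.Properties using (foldl-++; length-++; upTo-∷ʳ; map-++; concat-++; ++-identityʳ)
open import Data.List.Relation.Unary.All using (All; []; _∷_; universal)
open import Data.List.Relation.Unary.All.Properties using (++⁺; concat⁺; map⁺)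
open import Data.Fin using (Fin)
open import Data.Nat.Divisibility using (_∣_; ∣⇒≤; ∣-trans; m∣m*n; ∣n⇒∣m*n)
open import Function using (_∘_)
open import Relation.Binary.PropositionalEquality using (_≡_; refl; sym; trans; cong; subst; module ≡-Reasoning)
open import Data.Nat.Solver using (module +-*-Solver)
open +-*-Solver using (solve; _:+_; _:*_; _:=_)

value-++ : ∀ b xs ys → value b (xs ++ ys) ≡ value b xs * b ^ length ys + value b ys
value-++ b xs ys = trans (foldl-++ _ 0 xs ys) (value-from (value b xs) ys)
  where
  value-from : ∀ a ys → foldl (λ acc c → acc * b + c) a ys ≡ a * b ^ length ys + value b ys
  value-from a [] = sym (trans (+-identityʳ _) (*-identityʳ a))
  value-from a (y ∷ ys) = begin
      foldl _ (a * b + y) ys                       ≡⟨ value-from (a * b + y) ys ⟩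
      (a * b + y) * b ^ length ys + value b ys     ≡⟨ solve 5 (λ a b y P V → (a :* b :+ y) :* P :+ V := a :* (b :* P) :+ (y :* P :+ V)) refl a b y (b ^ length ys) (value b ys) ⟩
      a * (b * b ^ length ys) + (y * b ^ length ys + value b ys)  ≡⟨ cong (a * (b * b ^ length ys) +_) (sym (value-from y ys)) ⟩
      a * b ^ length (y ∷ ys) + value b (y ∷ ys)   ∎
    where open ≡-Reasoning

value<b^length : ∀ b ws → All (_< b) ws → value b ws < b ^ length ws
value<b^length b [] [] = s≤s z≤n
value<b^length b (w ∷ ws) (w<b ∷ ws<b) = begin-strict
    value b (w ∷ ws)                   ≡⟨ value-++ b [ w ] ws ⟩
    w * b ^ length ws + value b ws     <⟨ +-monoʳ-< (w * b ^ length ws) (value<b^length b ws ws<b) ⟩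
    w * b ^ length ws + b ^ length ws  ≡⟨ +-comm (w * b ^ length ws) _ ⟩
    suc w * b ^ length ws              ≤⟨ *-monoˡ-≤ (b ^ length ws) w<b ⟩
    b ^ length (w ∷ ws)                ∎
  where open ≤-Reasoning

digitsAux-< : ∀ b f u → All (_< b) (digitsAux b f u)
digitsAux-< zero    f       u       = []
digitsAux-< (suc b) zero    u       = []
digitsAux-< (suc b) (suc f) zero    = []
digitsAux-< (suc b) (suc f) (suc u) = ++⁺ (digitsAux-< (suc b) f _) (m%n<n (suc u) (suc b) ∷ [])

length-digitsAux : ∀ b f u e → u < b ^ e → length (digitsAux b f u) ≤ e
length-digitsAux zero    f       u       e _ = z≤n
length-digitsAux (suc b) zero    u       e _ = z≤n
length-digitsAux (suc b) (suc f) zero    e _ = z≤n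
length-digitsAux (suc b) (suc f) (suc u) zero    (s≤s ())
length-digitsAux (suc b) (suc f) (suc u) (suc e) u<b^e = begin
    length (digitsAux (suc b) f (suc u / suc b) ++ [ suc u % suc b ])  ≡⟨ length-++ (digitsAux (suc b) f _) ⟩
    length (digitsAux (suc b) f (suc u / suc b)) + 1                   ≤⟨ +-monoˡ-≤ 1 (length-digitsAux (suc b) f _ e quotient<) ⟩
    e + 1                                                              ≡⟨ +-comm e 1 ⟩
    suc e                                                              ∎
  where
  open ≤-Reasoning
  quotient< : suc u / suc b < suc b ^ e
  quotient< = m<n*o⇒m/o<n (subst (suc u <_) (*-comm (suc b) _) u<b^e)

value-digitsAux : ∀ {b} → 1 < b → ∀ f u → u ≤ f → value b (digitsAux b f u) ≡ u
value-digitsAux {suc zero} (s≤s ()) _ _ _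
value-digitsAux {suc (suc _)} _ zero    zero    _ = refl
value-digitsAux {suc (suc _)} _ (suc f) zero    _ = refl
value-digitsAux {b@(suc (suc _))} 1<b (suc f) (suc u) (s≤s u≤f) = begin
    value b (digitsAux b f w ++ [ x ])       ≡⟨ value-++ b (digitsAux b f w) [ x ] ⟩
    value b (digitsAux b f w) * (b * 1) + x  ≡⟨ cong (λ v → v * (b * 1) + x) (value-digitsAux 1<b f w w≤f) ⟩
    w * (b * 1) + x                          ≡⟨ cong (λ n → w * n + x) (*-identityʳ b) ⟩
    w * b + x                                ≡⟨ +-comm (w * b) x ⟩
    x + w * b                                ≡⟨ m≡m%n+[m/n]*n (suc u) b ⟨
    suc u                                    ∎
  where
  open ≡-Reasoning
  w = suc u / b
  x = suc u % b
  w≤f : w ≤ f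
  w≤f = ≤-trans (≤-pred (m/n<m (suc u) b 1<b)) u≤f

partialSum : (ℕ → ℕ) → ℕ → ℕ
partialSum f zero    = 0
partialSum f (suc n) = partialSum f n + f n

partialSum-mono-≤ : ∀ {f g} → (∀ j → f j ≤ g j) → ∀ n → partialSum f n ≤ partialSum g n
partialSum-mono-≤ f≤g zero    = z≤n
partialSum-mono-≤ f≤g (suc n) = +-mono-≤ (partialSum-mono-≤ f≤g n) (f≤g n)

partialSum-*ˡ : ∀ a f n → partialSum (λ j → a * f j) n ≡ a * partialSum f n
partialSum-*ˡ a f zero    = sym (*-zeroʳ a)
partialSum-*ˡ a f (suc n) = trans (cong (_+ a * f n) (partialSum-*ˡ a f n)) (sym (*-distribˡ-+ a _ (f n)))

partialSum*p≤last*[q+p] : ∀ p q (d : ℕ → ℕ) → (∀ i → d i * (q + p) ≤ d (suc i) * q) →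
                          ∀ i → partialSum d (suc i) * p ≤ d i * (q + p)
partialSum*p≤last*[q+p] p q d growth zero    = *-monoʳ-≤ (d 0) (m≤n+m p q)
partialSum*p≤last*[q+p] p q d growth (suc i) = begin
    (partialSum d (suc i) + d (suc i)) * p      ≡⟨ *-distribʳ-+ p (partialSum d (suc i)) (d (suc i)) ⟩
    partialSum d (suc i) * p + d (suc i) * p    ≤⟨ +-monoˡ-≤ _ (partialSum*p≤last*[q+p] p q d growth i) ⟩
    d i * (q + p) + d (suc i) * p               ≤⟨ +-monoˡ-≤ _ (growth i) ⟩
    d (suc i) * q + d (suc i) * p               ≡⟨ *-distribˡ-+ (d (suc i)) q p ⟨
    d (suc i) * (q + p)                         ∎
  where open ≤-Reasoning

concatMap-upTo-suc : ∀ {A : Set} (f : ℕ → List A) n → concatMap f (upTo (suc n)) ≡ concatMap f (upTo n) ++ f n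
concatMap-upTo-suc f n = begin
    concat (map f (upTo (suc n)))          ≡⟨ cong (concat ∘ map f) (upTo-∷ʳ n) ⟨
    concat (map f (upTo n ++ [ n ]))       ≡⟨ cong concat (map-++ f (upTo n) [ n ]) ⟩
    concat (map f (upTo n) ++ [ f n ])     ≡⟨ concat-++ (map f (upTo n)) [ f n ] ⟨
    concatMap f (upTo n) ++ (f n ++ [])    ≡⟨ cong (concatMap f (upTo n) ++_) (++-identityʳ (f n)) ⟩
    concatMap f (upTo n) ++ f n            ∎
  where open ≡-Reasoning

length-concatMap-upTo : ∀ {A : Set} (f : ℕ → List A) n → length (concatMap f (upTo n)) ≡ partialSum (length ∘ f) n
length-concatMap-upTo f zero    = refl
length-concatMap-upTo f (suc n) = begin
    length (concatMap f (upTo (suc n)))          ≡⟨ cong length (concatMap-upTo-suc f n) ⟩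
    length (concatMap f (upTo n) ++ f n)         ≡⟨ length-++ (concatMap f (upTo n)) ⟩
    length (concatMap f (upTo n)) + length (f n) ≡⟨ cong (_+ length (f n)) (length-concatMap-upTo f n) ⟩
    partialSum (length ∘ f) (suc n)              ∎
  where open ≡-Reasoning

value-concatMap-expansion< : ∀ b (ms : ℕ → ℕ) n →
  value b (concatMap (expansion b ∘ ms) (upTo n)) < b ^ partialSum (length ∘ expansion b ∘ ms) n
value-concatMap-expansion< b ms n =
  subst (λ L → value b w < b ^ L) (length-concatMap-upTo (expansion b ∘ ms) n)
    (value<b^length b w (concat⁺ (map⁺ (universal (λ j → digitsAux-< b (ms j) (ms j)) (upTo n)))))
  where w = concatMap (expansion b ∘ ms) (upTo n)

last≤value-concatMap-expansion : ∀ {b} → 1 < b → ∀ (ms : ℕ → ℕ) n →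
  ms n ≤ value b (concatMap (expansion b ∘ ms) (upTo (suc n)))
last≤value-concatMap-expansion {b} 1<b ms n = begin
    ms n                                                  ≡⟨ value-digitsAux 1<b (ms n) (ms n) ≤-refl ⟨
    value b a                                             ≤⟨ m≤n+m (value b a) _ ⟩
    value b w * b ^ length a + value b a                  ≡⟨ value-++ b w a ⟨
    value b (w ++ a)                                      ≡⟨ cong (value b) (concatMap-upTo-suc (expansion b ∘ ms) n) ⟨
    value b (concatMap (expansion b ∘ ms) (upTo (suc n))) ∎
  where
  open ≤-Reasoning
  w = concatMap (expansion b ∘ ms) (upTo n)
  a = expansion b (ms n)

n<2^n : ∀ n → n < 2 ^ n
n<2^n zero    = s≤s z≤n
n<2^n (suc n) = +-mono-≤-< (m^n>0 2 n) (subst (n <_) (sym (+-identityʳ (2 ^ n))) (n<2^n n))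

m∣m^n : ∀ m {n} → 1 ≤ n → m ∣ m ^ n
m∣m^n m {suc n} _ = m∣m*n (m ^ n)

∣-prodF : ∀ l (f : Fin l → ℕ) j → f j ∣ prodF l f
∣-prodF (suc l) f Fin.zero    = m∣m*n _
∣-prodF (suc l) f (Fin.suc j) = ∣n⇒∣m*n (f Fin.zero) (∣-prodF l (f ∘ Fin.suc) j)

a^∑e≤∏s^e : ∀ l (s e : Fin l → ℕ) {a} → (∀ j → a ≤ s j) → a ^ sumF l e ≤ prodF l (λ j → s j ^ e j)
a^∑e≤∏s^e zero    s e a≤s = ≤-refl
a^∑e≤∏s^e (suc l) s e {a} a≤s = begin
    a ^ (e Fin.zero + sumF l (e ∘ Fin.suc))        ≡⟨ ^-distribˡ-+-* a (e Fin.zero) _ ⟩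
    a ^ e Fin.zero * a ^ sumF l (e ∘ Fin.suc)      ≤⟨ *-mono-≤ (^-monoˡ-≤ (e Fin.zero) (a≤s Fin.zero)) (a^∑e≤∏s^e l (s ∘ Fin.suc) (e ∘ Fin.suc) (a≤s ∘ Fin.suc)) ⟩
    prodF (suc l) (λ j → s j ^ e j)                ∎
  where open ≤-Reasoning

∏s^e≤a^∑e : ∀ l (s e : Fin l → ℕ) {a} → (∀ j → s j ≤ a) → prodF l (λ j → s j ^ e j) ≤ a ^ sumF l e
∏s^e≤a^∑e zero    s e s≤a = ≤-refl
∏s^e≤a^∑e (suc l) s e {a} s≤a = begin
    prodF (suc l) (λ j → s j ^ e j)                ≤⟨ *-mono-≤ (^-monoˡ-≤ (e Fin.zero) (s≤a Fin.zero)) (∏s^e≤a^∑e l (s ∘ Fin.suc) (e ∘ Fin.suc) (s≤a ∘ Fin.suc)) ⟩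
    a ^ e Fin.zero * a ^ sumF l (e ∘ Fin.suc)      ≡⟨ ^-distribˡ-+-* a (e Fin.zero) _ ⟨
    a ^ sumF (suc l) e                             ∎
  where open ≤-Reasoning

uSeq-lower : ∀ {b} l s r → 1 < b → (∀ j → 2 ≤ s j) → ∀ i → b ^ dSeq l r i ≤ uSeq b l s r i ^ b
uSeq-lower {b} l s r 1<b 2≤s i = begin
    b ^ d                  ≤⟨ ^-monoˡ-≤ d (<⇒≤ (n<2^n b)) ⟩
    (2 ^ b) ^ d            ≡⟨ ^-*-assoc 2 b d ⟩
    2 ^ (b * d)            ≡⟨ cong (2 ^_) (*-comm b d) ⟩
    2 ^ (d * b)            ≡⟨ ^-*-assoc 2 d b ⟨
    (2 ^ d) ^ b            ≤⟨ ^-monoˡ-≤ b (a^∑e≤∏s^e l s (r i) 2≤s) ⟩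
    mSeq l s r i ^ b       ≤⟨ ^-monoˡ-≤ b (last≤value-concatMap-expansion 1<b (mSeq l s r) i) ⟩
    uSeq b l s r i ^ b     ∎
  where
  open ≤-Reasoning
  d = dSeq l r i

uSeq-upper : ∀ {b} l s r → 1 < b → (∀ j → s j ≤ b) → (∀ i → 0 < dSeq l r i) →
             ∀ p q → (∀ i → dSeq l r i * (q + p) ≤ dSeq l r (suc i) * q) →
             ∀ i → uSeq b l s r i ^ p ≤ b ^ (2 * (q + p) * dSeq l r i)
uSeq-upper {b} l s r 1<b s≤b d>0 p q growth i = begin
    uSeq b l s r i ^ p  ≤⟨ ^-monoˡ-≤ p (<⇒≤ (value-concatMap-expansion< b (mSeq l s r) (suc i))) ⟩
    (b ^ L) ^ p         ≡⟨ ^-*-assoc b L p ⟩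
    b ^ (L * p)         ≤⟨ ^-monoʳ-≤ b L*p≤ ⟩
    b ^ (2 * (q + p) * d i)  ∎
  where
  open ≤-Reasoning
  instance
    b≢0 : NonZero b
    b≢0 = >-nonZero (<-trans (s≤s z≤n) 1<b)
  d = dSeq l r
  ℓ = length ∘ expansion b ∘ mSeq l s r
  L = partialSum ℓ (suc i)
  -- mⱼ = b^dⱼ is possible, with dⱼ + 1 digits; dⱼ ≥ 1 makes 2dⱼ enough.
  ℓ≤2d : ∀ j → ℓ j ≤ 2 * d j
  ℓ≤2d j = length-digitsAux b _ _ (2 * d j) (begin-strict
    mSeq l s r j   ≤⟨ ∏s^e≤a^∑e l s (r j) s≤b ⟩
    b ^ d j        <⟨ ^-monoʳ-< b 1<b (m<m+n (d j) (≤-trans (d>0 j) (m≤m+n (d j) 0))) ⟩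
    b ^ (2 * d j)  ∎)
  L*p≤ : L * p ≤ 2 * (q + p) * d i
  L*p≤ = begin
    L * p                                   ≤⟨ *-monoˡ-≤ p (partialSum-mono-≤ ℓ≤2d (suc i)) ⟩
    partialSum (λ j → 2 * d j) (suc i) * p  ≡⟨ cong (_* p) (partialSum-*ˡ 2 d (suc i)) ⟩
    2 * partialSum d (suc i) * p            ≡⟨ *-assoc 2 (partialSum d (suc i)) p ⟩
    2 * (partialSum d (suc i) * p)          ≤⟨ *-monoʳ-≤ 2 (partialSum*p≤last*[q+p] p q d growth i) ⟩
    2 * (d i * (q + p))                     ≡⟨ cong (2 *_) (*-comm (d i) (q + p)) ⟩
    2 * ((q + p) * d i)                     ≡⟨ *-assoc 2 (q + p) (d i) ⟨
    2 * (q + p) * d i                       ∎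

proposition4p6 :
    (b l : ℕ) → 2 ≤ b → 1 ≤ l →
    (s k : Fin l → ℕ) →
    (∀ j → Prime (s j)) →
    (∀ j j′ → j Data.Fin.< j′ → s j < s j′) →
    (∀ j → 1 ≤ k j) →
    b ≡ prodF l (λ j → s j ^ k j) →
    (r : ℕ → Fin l → ℕ) →
    (∀ i → 0 < dSeq l r i) →
    -- ε = p / q > 0 with d_{i+1} / d_i ≥ 1 + ε for all i
    Σ ℕ (λ p → Σ ℕ (λ q → 0 < p × 0 < q ×
      (∀ i → dSeq l r i * (q + p) ≤ dSeq l r (suc i) * q))) →
    -- c = p / q, c′ = p′ / q′ with 0 < c ≤ c′
    Σ ℕ (λ p → Σ ℕ (λ q → Σ ℕ (λ p′ → Σ ℕ (λ q′ →
      0 < p × 0 < q × 0 < q′ × p * q′ ≤ p′ * q ×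
      (∀ i → b ^ (p * dSeq l r i) ≤ uSeq b l s r i ^ q
           × uSeq b l s r i ^ q′ ≤ b ^ (p′ * dSeq l r i))))))
proposition4p6 b l 1<b _ s k prime _ 1≤k b≡∏s^k r d>0 (p , q , p>0 , _ , growth) =
  1 , b , 2 * (q + p) , p , s≤s z≤n , <-trans (s≤s z≤n) 1<b , p>0 , c≤c′ ,
  λ i → subst (λ e → b ^ e ≤ uSeq b l s r i ^ b) (sym (*-identityˡ (dSeq l r i))) (uSeq-lower l s r 1<b 2≤s i)
      , uSeq-upper l s r 1<b s≤b d>0 p q growth i
  where
  instance
    b≢0 : NonZero b
    b≢0 = >-nonZero (<-trans (s≤s z≤n) 1<b)
  2≤s : ∀ j → 2 ≤ s j
  2≤s j = nonTrivial⇒n>1 (s j) {{prime⇒nonTrivial (prime j)}}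
  s≤b : ∀ j → s j ≤ b
  s≤b j = ∣⇒≤ (∣-trans (m∣m^n (s j) (1≤k j)) (subst (s j ^ k j ∣_) (sym b≡∏s^k) (∣-prodF l (λ j → s j ^ k j) j)))
  c≤c′ : 1 * p ≤ 2 * (q + p) * b
  c≤c′ = begin
    1 * p              ≡⟨ *-identityˡ p ⟩
    p                  ≤⟨ m≤n+m p q ⟩
    q + p              ≤⟨ m≤m+n (q + p) _ ⟩
    2 * (q + p)        ≤⟨ m≤m*n (2 * (q + p)) b ⟩
    2 * (q + p) * b    ∎
    where open ≤-Reasoning
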